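{- Let $\phi$ be an unsatisfiable boolean formula in conjunctive normal form with $n$ clauses (indexed $1,\dots,n$), in which every clause contains exactly $4$ terms and no clause contains the same terminal more than once. Construct the 3CNF formula $\phi'$ as follows: for each $i\in\{1,\dots,n\}$, let $a_{i,1},a_{i,2},a_{i,3},a_{i,4}$ be the first, second, third and fourth terms of the $i$-th clause of $\phi$, let $x_i$ be a new terminal not appearing in $\phi$ (with $x_1,\dots,x_n$ pairwise distinct), and form the two clauses $(a_{i,1}\lor a_{i,2}\lor x_i)$ and $(a_{i,3}\lor a_{i,4}\lor \overline{x_i})$; let $\phi'$ be the conjunction of these $2n$ clauses. Then Quigley's algorithm, run on input $\phi'$, outputs ``satisfiable''. Consequently (as $\phi'$ is unsatisfiable) Quigley's algorithm gives an incorrect answer on $\phi'$.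
   Context: A terminal is a boolean variable; a term is a terminal $t$ or its negation $\overline{t}$. A clause is a disjunction of terms, treated as a set of terms (order irrelevant, no duplicate terms); its length is its number of terms. An instance is a conjunction of clauses (a set of clauses). Clauses containing both $t$ and $\overline{t}$ for some terminal $t$ are never stored. Resolution (Quigley's Lemma 5.9): if clauses $C$ and $D$ contain a terminal $t$ that is positive in one and negated in the other, they imply the clause consisting of all terms of $C$ and $D$ except those containing $t$ (each shared term appearing once). The clauses "implied by $C$ and $D$" are all clauses obtained this way, for every such terminal $t$. Expansion (Quigley's Lemma 5.8): a clause $C$ and a terminal $t$ of the instance not occurring in $C$ imply the clauses $C\lor t$ and $C\lor\overline{t}$; iterating, "expanding $C$ to length at most 3" yields all clauses of length at most $3$ that contain all terms of $C$ plus additional terms on terminals of the instance not in $C$. Quigley's algorithm (on an instance): repeat the following round. (1) Let $L$ be an empty list. For each clause $C$ of length at most $3$ currently in the instance: for each clause $D$ of length at most $3$ currently in the instance, append to $L$ every clause of length at most $3$ implied by $C$ and $D$ by resolution that contains no complementary pair of terms and is not already in the instance; then append to $L$ all clauses obtained by expanding $C$ to length at most $3$. (Clauses of length $\ge 4$ are never added.) After all pairs are processed, add each clause of $L$ not already in the instance to the instance (so clauses produced in a round are only used from the next round on). (2) If the instance contains two length-$1$ clauses $\{t\}$ and $\{\overline{t}\}$ for some terminal $t$, output ``unsatisfiable'' and stop. (3) If no new clause was added in this round, output ``satisfiable'' and stop; otherwise start a new round. -}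

module Defs where

open import Data.Nat using (ℕ; zero; suc; _≤_)
open import Data.Bool using (Bool; true; false)
open import Data.Fin using (Fin)
open import Data.Fin.Patterns using (0F; 1F; 2F; 3F)
open import Data.List using (List; []; _∷_; length; concatMap; map)
open import Data.List.Base using (allFin)
open import Data.List.Membership.Propositional using (_∈_)
open import Data.List.Relation.Unary.Any using (Any)
open import Data.List.Relation.Unary.All using (All)
open import Data.List.Relation.Unary.Unique.Propositional using (Unique)
open import Data.Product using (Σ; ∃; _×_; _,_; proj₁)
open import Data.Sum using (_⊎_)
open import Data.Empty using (⊥)
open import Relation.Nullary using (¬_)
open import Relation.Binary.PropositionalEquality using (_≡_; _≢_)

-- Terminals are natural numbers.  A term is a terminal with a polarity:
-- (t , true) is t, (t , false) is its negation.
Terminal : Set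
Terminal = ℕ

Term : Set
Term = Terminal × Bool

terminal : Term → Terminal
terminal = proj₁

-- A clause is a finite set of terms, represented by a duplicate-free list
-- (order irrelevant: all notions below depend only on membership).
Clause : Set
Clause = List Term

Instance : Set
Instance = List Clause

_≈C_ : Clause → Clause → Set
C ≈C D = ∀ s → (s ∈ C → s ∈ D) × (s ∈ D → s ∈ C)

NoComplementary : Clause → Set
NoComplementary C = ∀ t → (t , true) ∈ C → (t , false) ∈ C → ⊥

ValidClause : Clause → Set
ValidClause C = Unique C × NoComplementary C

Assignment : Set
Assignment = Terminal → Bool

TermTrue : Assignment → Term → Set
TermTrue v (t , b) = v t ≡ b

ClauseTrue : Assignment → Clause → Set
ClauseTrue v C = Any (TermTrue v) C

Satisfiable : Instance → Set
Satisfiable I = Σ Assignment λ v → All (ClauseTrue v) I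

ResolventOn : Terminal → Clause → Clause → Clause → Set
ResolventOn t C D R =
  (((t , true) ∈ C × (t , false) ∈ D) ⊎ ((t , false) ∈ C × (t , true) ∈ D))
  × Unique R
  × (∀ s → (s ∈ R → (s ∈ C ⊎ s ∈ D) × terminal s ≢ t)
         × ((s ∈ C ⊎ s ∈ D) × terminal s ≢ t → s ∈ R))

-- Clauses present in the instance after k rounds of Quigley's algorithm
-- run on input I (round 0 = the input itself).  Membership is up to set
-- equality of clauses.
data InRound (I : Instance) : ℕ → Clause → Set where
  input : ∀ {C D} → D ∈ I → Unique C → C ≈C D → InRound I 0 C
  keep  : ∀ {k C} → InRound I k C → InRound I (suc k) C
  resolve : ∀ {k C D R} (t : Terminal) →
    InRound I k C → length C ≤ 3 →
    InRound I k D → length D ≤ 3 →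
    ResolventOn t C D R → NoComplementary R → length R ≤ 3 →
    InRound I (suc k) R
  -- Expansion (Lemma 5.8), iterated: all clauses of length ≤ 3 containing
  -- all terms of C plus extra terms on terminals of the current instance.
  expand : ∀ {k C E} →
    InRound I k C → length C ≤ 3 →
    ValidClause E → (∀ s → s ∈ C → s ∈ E) →
    (∀ s → s ∈ E → ∃ λ F → InRound I k F × Any (λ u → terminal u ≡ terminal s) F) →
    length E ≤ 3 →
    InRound I (suc k) E

Contradiction : Instance → ℕ → Set
Contradiction I k = ∃ λ t → InRound I k ((t , true) ∷ []) × InRound I k ((t , false) ∷ [])

NoNewClause : Instance → ℕ → Set
NoNewClause I k = ∀ C → InRound I (suc k) C → InRound I k C

-- Quigley's algorithm outputs "satisfiable" on I: some round (suc r) adds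
-- nothing new, and no round 1, …, suc r triggered the unsatisfiable exit.
-- (Since instances grow monotonically, the first such round then also has
-- no contradiction, so this is exactly the algorithm's output.)
QuigleyOutputsSatisfiable : Instance → Set
QuigleyOutputsSatisfiable I =
  ∃ λ r → NoNewClause I r × (∀ j → 1 ≤ j → j ≤ suc r → ¬ Contradiction I j)

-- The 4CNF formula φ with n clauses, φ i k being the (k+1)-th term of clause i.
fourCNF : (n : ℕ) → (Fin n → Fin 4 → Term) → Instance
fourCNF n φ = map (λ i → φ i 0F ∷ φ i 1F ∷ φ i 2F ∷ φ i 3F ∷ []) (allFin n)

phi′ : (n : ℕ) → (Fin n → Fin 4 → Term) → (Fin n → Terminal) → Instance
phi′ n φ x = concatMap
  (λ i → (φ i 0F ∷ φ i 1F ∷ (x i , true) ∷ [])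
       ∷ (φ i 2F ∷ φ i 3F ∷ (x i , false) ∷ []) ∷ [])
  (allFin n)

{-# OPTIONS --safe #-}
-- Every clause of the first round of resolution on φ′ has exactly three terms on three distinct
-- terminals, and a resolvent of two such clauses has length at most 3 only if the two
-- non-pivot pairs share a term.  Resolving two halves of φ′ therefore yields only "crossing"
-- clauses {ℓ, x_i, x_k}, where ℓ occurs in rows i and k next to complementary pivots.  A crossing
-- clause has no short resolvent with a half or another crossing clause: each candidate overlap
-- would put complementary terms into one row of φ, or the same terminal twice into one row.
-- Expanding a three-term clause to length 3 gives the clause itself.  Hence round 2 adds
-- nothing, no unit clause ever appears, and the algorithm answers "satisfiable", although φ′
-- is unsatisfiable since resolving its halves on x_i recovers φ.
module Submission where

open import Defs
open import Data.Nat using (ℕ; suc; _≤_; z≤n; s≤s) renaming (_≟_ to _≟ℕ_)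
open import Data.Nat.Properties using (≤-trans; n≮n)
open import Data.Bool using (Bool; true; false; not)
import Data.Bool.Properties as Bool
open import Data.Fin using (Fin)
open import Data.Fin.Patterns using (0F; 1F; 2F; 3F)
open import Data.Product using (_×_; _,_; ∃; ∃₂; proj₁; proj₂)
import Data.Product as Product
open import Data.Product.Properties using (≡-dec)
open import Data.Sum using (_⊎_; inj₁; inj₂)
import Data.Sum as Sum
open import Data.Empty using (⊥; ⊥-elim)
open import Data.List using (List; []; _∷_; length; removeAt; allFin)
open import Data.List.Properties using (length-removeAt′)
open import Data.List.Membership.Propositional using (_∈_)
open import Data.List.Membership.Propositional.Properties using (∈-concatMap⁻)
open import Data.List.Relation.Unary.Any using (here; there; index; satisfied)
open import Data.List.Relation.Unary.All using ([]; _∷_)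
import Data.List.Relation.Unary.All as All
open import Data.List.Relation.Unary.All.Properties using (¬Any⇒All¬; map⁺; map⁻; concat⁻)
open import Data.List.Relation.Unary.AllPairs using ([]; _∷_)
open import Data.List.Relation.Unary.Unique.Propositional using (Unique)
open import Data.List.Relation.Binary.Subset.Propositional using (_⊆_)
open import Data.List.Relation.Binary.Permutation.Propositional using (_↭_; ↭-refl; ↭-prep; ↭-swap; ↭-sym)
open import Data.List.Relation.Binary.Permutation.Propositional.Properties using (∈-resp-↭)
open import Relation.Nullary using (¬_; yes; no)
open import Relation.Binary.Definitions using (DecidableEquality)
open import Relation.Binary.PropositionalEquality using (_≡_; _≢_; refl; sym; trans; cong; subst)

_≟ₜ_ : DecidableEquality Term
_≟ₜ_ = ≡-dec _≟ℕ_ Bool._≟_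

open import Data.List.Membership.DecPropositional _≟ₜ_ using (_∈?_)

∈-removeAt : ∀ {A : Set} {x y : A} {xs} (x∈xs : x ∈ xs) → y ∈ xs → x ≢ y → y ∈ removeAt xs (index x∈xs)
∈-removeAt (here refl) (here refl) x≢y = ⊥-elim (x≢y refl)
∈-removeAt (here refl) (there y∈xs) _  = y∈xs
∈-removeAt (there _)   (here refl)  _  = here refl
∈-removeAt (there x∈xs) (there y∈xs) x≢y = there (∈-removeAt x∈xs y∈xs x≢y)

Unique-⊆⇒length≤ : ∀ {A : Set} {xs ys : List A} → Unique xs → xs ⊆ ys → length xs ≤ length ys
Unique-⊆⇒length≤ [] _ = z≤n
Unique-⊆⇒length≤ {xs = x ∷ xs} {ys} (x∉xs ∷ u) xs⊆ys =
  subst (suc (length xs) ≤_) (sym (length-removeAt′ ys (index x∈ys)))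
    (s≤s (Unique-⊆⇒length≤ u λ y∈xs → ∈-removeAt x∈ys (xs⊆ys (there y∈xs)) (All.lookup x∉xs y∈xs)))
  where
  x∈ys = xs⊆ys (here refl)

≈C⇒⊆ : ∀ {C D} → C ≈C D → C ⊆ D
≈C⇒⊆ C≈D = proj₁ (C≈D _)

≈C⇒⊇ : ∀ {C D} → C ≈C D → D ⊆ C
≈C⇒⊇ C≈D = proj₂ (C≈D _)

⊆⊇⇒≈C : ∀ {C D} → C ⊆ D → D ⊆ C → C ≈C D
⊆⊇⇒≈C C⊆D D⊆C _ = C⊆D , D⊆C

≈C-trans : ∀ {C D E} → C ≈C D → D ≈C E → C ≈C E
≈C-trans C≈D D≈E = ⊆⊇⇒≈C (λ p → ≈C⇒⊆ D≈E (≈C⇒⊆ C≈D p)) (λ p → ≈C⇒⊇ C≈D (≈C⇒⊇ D≈E p))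

≈C-sym : ∀ {C D} → C ≈C D → D ≈C C
≈C-sym C≈D s = Product.swap (C≈D s)

≈C-resp-↭ : ∀ {C D E} → C ≈C D → D ↭ E → C ≈C E
≈C-resp-↭ C≈D D↭E = ⊆⊇⇒≈C (λ p → ∈-resp-↭ D↭E (≈C⇒⊆ C≈D p)) (λ p → ≈C⇒⊇ C≈D (∈-resp-↭ (↭-sym D↭E) p))

∈-triple : ∀ {s a b c : Term} → s ∈ a ∷ b ∷ c ∷ [] → s ≡ a ⊎ s ≡ b ⊎ s ≡ c
∈-triple (here e)                 = inj₁ e
∈-triple (there (here e))         = inj₂ (inj₁ e)
∈-triple (there (there (here e))) = inj₂ (inj₂ e)

short-superset-≈ : ∀ {a b c E} → Unique (a ∷ b ∷ c ∷ []) → a ∷ b ∷ c ∷ [] ⊆ E → length E ≤ 3 →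
  E ≈C (a ∷ b ∷ c ∷ [])
short-superset-≈ {a} {b} {c} {E} distinct abc⊆E len = ⊆⊇⇒≈C E⊆abc abc⊆E
  where
  E⊆abc : E ⊆ a ∷ b ∷ c ∷ []
  E⊆abc {s} s∈E with s ∈? a ∷ b ∷ c ∷ []
  ... | yes s∈abc = s∈abc
  ... | no s∉abc  = ⊥-elim (n≮n 3 (≤-trans (Unique-⊆⇒length≤ s∷abc-distinct s∷abc⊆E) len))
    where
    s∷abc-distinct : Unique (s ∷ a ∷ b ∷ c ∷ [])
    s∷abc-distinct = ¬Any⇒All¬ _ s∉abc ∷ distinct
    s∷abc⊆E : s ∷ a ∷ b ∷ c ∷ [] ⊆ E
    s∷abc⊆E (here refl) = s∈E
    s∷abc⊆E (there p)   = abc⊆E p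

record ThreeTerms (C : Clause) : Set where
  constructor three
  field
    {a b c}  : Term
    distinct : Unique (a ∷ b ∷ c ∷ [])
    members  : C ≈C (a ∷ b ∷ c ∷ [])

ThreeTerms⇒3≤length : ∀ {C} → ThreeTerms C → 3 ≤ length C
ThreeTerms⇒3≤length (three distinct members) = Unique-⊆⇒length≤ distinct (≈C⇒⊇ members)

ThreeTerms-⊆-short : ∀ {C E} → ThreeTerms C → C ⊆ E → length E ≤ 3 → E ≈C C
ThreeTerms-⊆-short (three distinct members) C⊆E len =
  ≈C-trans (short-superset-≈ distinct (λ p → C⊆E (≈C⇒⊇ members p)) len) (≈C-sym members)

negate : Term → Term
negate (t , c) = (t , not c)

negate-≢ : ∀ {s} → negate s ≢ s
negate-≢ e = Bool.not-¬ refl (sym (cong proj₂ e))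

negate-involutive : ∀ s → negate (negate s) ≡ s
negate-involutive (t , c) = cong (t ,_) (Bool.not-involutive c)

resolvent-pivot : ∀ {t C D R} → ResolventOn t C D R → ∃ λ s → terminal s ≡ t × s ∈ C × negate s ∈ D
resolvent-pivot {t} (inj₁ (p , q) , _) = (t , true)  , refl , p , q
resolvent-pivot {t} (inj₂ (p , q) , _) = (t , false) , refl , p , q

resolvent-⊇ : ∀ {t C D R s} → ResolventOn t C D R → s ∈ C ⊎ s ∈ D → terminal s ≢ t → s ∈ R
resolvent-⊇ (_ , _ , R≈) s∈C∪D off = proj₂ (R≈ _) (s∈C∪D , off)

ResolventOn-sym : ∀ {t C D R} → ResolventOn t C D R → ResolventOn t D C R
ResolventOn-sym (pivot , unique , R≈) =
  Sum.swap pivot′ , unique ,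
  λ s → (λ s∈R → Sum.swap (proj₁ (proj₁ (R≈ s) s∈R)) , proj₂ (proj₁ (R≈ s) s∈R)) ,
        (λ (s∈D∪C , off) → proj₂ (R≈ s) (Sum.swap s∈D∪C , off))
  where
  pivot′ = Sum.map Product.swap Product.swap pivot

ResolventOn-resp-≈ : ∀ {t C D R E} → Unique E → E ≈C R → ResolventOn t C D R → ResolventOn t C D E
ResolventOn-resp-≈ uniqueE E≈R (pivot , _ , R≈) =
  pivot , uniqueE ,
  λ s → (λ s∈E → proj₁ (R≈ s) (≈C⇒⊆ E≈R s∈E)) , (λ h → ≈C⇒⊇ E≈R (proj₂ (R≈ s) h))

record Remainder (t : Terminal) (C : Clause) (a b : Term) : Set where
  constructor remainder
  field
    a∈C   : a ∈ C
    b∈C   : b ∈ C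
    a≢b   : a ≢ b
    a-off : terminal a ≢ t
    b-off : terminal b ≢ t

remainder-⊆ : ∀ {t C D R a b} → ResolventOn t C D R → Remainder t C a b → a ∈ R × b ∈ R
remainder-⊆ res (remainder a∈C b∈C _ a-off b-off) =
  resolvent-⊇ res (inj₁ a∈C) a-off , resolvent-⊇ res (inj₁ b∈C) b-off

resolvent-too-long : ∀ {t C D R a b c d} → ResolventOn t C D R →
  Remainder t C a b → Remainder t D c d →
  a ≢ c → a ≢ d → b ≢ c → b ≢ d → length R ≤ 3 → ⊥
resolvent-too-long res rC rD a≢c a≢d b≢c b≢d len =
  n≮n 3 (≤-trans (Unique-⊆⇒length≤ distinct (All.lookup (a∈R ∷ b∈R ∷ c∈R ∷ d∈R ∷ []))) len)
  where
  distinct = (Remainder.a≢b rC ∷ a≢c ∷ a≢d ∷ []) ∷ (b≢c ∷ b≢d ∷ []) ∷ (Remainder.a≢b rD ∷ []) ∷ [] ∷ []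
  a∈R = proj₁ (remainder-⊆ res rC)
  b∈R = proj₂ (remainder-⊆ res rC)
  c∈R = proj₁ (remainder-⊆ (ResolventOn-sym res) rD)
  d∈R = proj₂ (remainder-⊆ (ResolventOn-sym res) rD)

-- Positions 0, 1 of a row go to the half containing x_i, positions 2, 3 to the half containing ¬x_i.
side : Fin 4 → Bool
side 0F = true
side 1F = true
side 2F = false
side 3F = false

partner : Fin 4 → Fin 4
partner 0F = 1F
partner 1F = 0F
partner 2F = 3F
partner 3F = 2F

side-partner : ∀ j → side (partner j) ≡ side j
side-partner 0F = refl
side-partner 1F = refl
side-partner 2F = refl
side-partner 3F = refl

partner-involutive : ∀ j → partner (partner j) ≡ j
partner-involutive 0F = refl
partner-involutive 1F = refl
partner-involutive 2F = refl
partner-involutive 3F = refl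

partner-≢ : ∀ j → partner j ≢ j
partner-≢ 0F ()
partner-≢ 1F ()
partner-≢ 2F ()
partner-≢ 3F ()

same-side : ∀ a b → side a ≡ side b → a ≡ b ⊎ a ≡ partner b
same-side 0F 0F _ = inj₁ refl
same-side 0F 1F _ = inj₂ refl
same-side 1F 0F _ = inj₂ refl
same-side 1F 1F _ = inj₁ refl
same-side 2F 2F _ = inj₁ refl
same-side 2F 3F _ = inj₂ refl
same-side 3F 2F _ = inj₂ refl
same-side 3F 3F _ = inj₁ refl
same-side 0F 2F ()
same-side 0F 3F ()
same-side 1F 2F ()
same-side 1F 3F ()
same-side 2F 0F ()
same-side 2F 1F ()
same-side 3F 0F ()
same-side 3F 1F ()

halves-true⇒row-true : ∀ {v a₀ a₁ a₂ a₃ y} →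
  ClauseTrue v (a₀ ∷ a₁ ∷ (y , true) ∷ []) → ClauseTrue v (a₂ ∷ a₃ ∷ (y , false) ∷ []) →
  ClauseTrue v (a₀ ∷ a₁ ∷ a₂ ∷ a₃ ∷ [])
halves-true⇒row-true (here a₀-true)                _                            = here a₀-true
halves-true⇒row-true (there (here a₁-true))        _                            = there (here a₁-true)
halves-true⇒row-true (there (there (here _)))      (here a₂-true)               = there (there (here a₂-true))
halves-true⇒row-true (there (there (here _)))      (there (here a₃-true))       = there (there (there (here a₃-true)))
halves-true⇒row-true (there (there (here y-true))) (there (there (here y-false))) = ⊥-elim (Bool.not-¬ y-true y-false)

phi′-satisfiable⇒fourCNF-satisfiable : ∀ n φ x → Satisfiable (phi′ n φ x) → Satisfiable (fourCNF n φ)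
phi′-satisfiable⇒fourCNF-satisfiable n φ x (v , sat) =
  v , map⁺ (All.map (λ { (h₁ ∷ h₂ ∷ []) → halves-true⇒row-true h₁ h₂ }) (map⁻ (concat⁻ sat)))

module _ (n : ℕ) (φ : Fin n → Fin 4 → Term)
         (φ-distinct : ∀ i j k → terminal (φ i j) ≡ terminal (φ i k) → j ≡ k)
         (x : Fin n → Terminal)
         (x-injective : ∀ i j → x i ≡ x j → i ≡ j)
         (x-fresh : ∀ i j k → x i ≢ terminal (φ j k)) where

  φ′ : Instance
  φ′ = phi′ n φ x

  φ≢x : ∀ {i j k b} → φ i j ≢ (x k , b)
  φ≢x {i} {j} {k} e = x-fresh k i j (sym (cong terminal e))

  x≢φ : ∀ {i j k b} → (x k , b) ≢ φ i j
  x≢φ e = φ≢x (sym e)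

  row-positions-apart : ∀ {i a b} → a ≢ b → φ i a ≢ φ i b
  row-positions-apart {i} {a} {b} a≢b e = a≢b (φ-distinct i a b (cong terminal e))

  partner-apart : ∀ {i j} → φ i j ≢ φ i (partner j)
  partner-apart {j = j} = row-positions-apart (λ e → partner-≢ j (sym e))

  opposite-sides-apart : ∀ {i a b j l} → side l ≡ not (side j) → side a ≡ side j → side b ≡ side l →
    φ i a ≢ φ i b
  opposite-sides-apart sl sa sb =
    row-positions-apart (λ a≡b → Bool.not-¬ refl (trans (cong side a≡b) (trans sb (trans sl (cong not (sym sa))))))

  complementary-rows-apart : ∀ {i a m b s} → φ i a ≡ s → φ m b ≡ negate s → i ≢ m
  complementary-rows-apart {i} {a} {_} {b} e e′ refl =
    negate-≢ (trans (sym e′) (trans (cong (φ i) (sym a≡b)) e))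
    where
    a≡b = φ-distinct i a b (trans (cong terminal e) (sym (cong terminal e′)))

  complementary-x-apart : ∀ {i a m b s c d} → φ i a ≡ s → φ m b ≡ negate s → (x i , c) ≢ (x m , d)
  complementary-x-apart e e′ eq = complementary-rows-apart e e′ (x-injective _ _ (cong terminal eq))

  halfClause : Fin n → Fin 4 → Clause
  halfClause i j = φ i j ∷ φ i (partner j) ∷ (x i , side j) ∷ []

  Half : Fin n → Fin 4 → Clause → Set
  Half i j C = C ≈C halfClause i j

  -- C is the resolvent, on the terminal of φ i j, of the halves of rows i and k containing
  -- positions j and l; its term ℓ = φ i (partner j) lies in both rows.
  record Crossing (i : Fin n) (j : Fin 4) (k : Fin n) (l : Fin 4) (C : Clause) : Set where
    field
      shared  : φ i (partner j) ≡ φ k (partner l)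
      pivot   : φ k l ≡ negate (φ i j)
      members : C ≈C (φ i (partner j) ∷ (x i , side j) ∷ (x k , side l) ∷ [])

  Crossed : Clause → Set
  Crossed C = ∃₂ λ i j → ∃₂ λ k l → Crossing i j k l C

  data Shape (C : Clause) : Set where
    half     : ∀ {i j} → Half i j C → Shape C
    crossing : ∀ {i j k l} → Crossing i j k l C → Shape C

  Half-partner : ∀ {i C} j → Half i j C → Half i (partner j) C
  Half-partner 0F h = ≈C-resp-↭ h (↭-swap _ _ ↭-refl)
  Half-partner 1F h = ≈C-resp-↭ h (↭-swap _ _ ↭-refl)
  Half-partner 2F h = ≈C-resp-↭ h (↭-swap _ _ ↭-refl)
  Half-partner 3F h = ≈C-resp-↭ h (↭-swap _ _ ↭-refl)

  Crossing-swap : ∀ {i j k l C} → Crossing i j k l C → Crossing k l i j C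
  Crossing-swap {C = C} c = record
    { shared  = sym shared
    ; pivot   = sym (trans (cong negate pivot) (negate-involutive _))
    ; members = ≈C-resp-↭ (subst (λ u → C ≈C (u ∷ _)) shared members) (↭-prep _ (↭-swap _ _ ↭-refl))
    }
    where open Crossing c

  Crossing-rows-apart : ∀ {i j k l C} → Crossing i j k l C → i ≢ k
  Crossing-rows-apart c = complementary-rows-apart refl (Crossing.pivot c)

  crossing-distinct : ∀ {i j k l} → φ k l ≡ negate (φ i j) →
    Unique (φ i (partner j) ∷ (x i , side j) ∷ (x k , side l) ∷ [])
  crossing-distinct pivot = (φ≢x ∷ φ≢x ∷ []) ∷ (complementary-x-apart refl pivot ∷ []) ∷ [] ∷ []

  shape-three : ∀ {C} → Shape C → ThreeTerms C
  shape-three (half h)     = three ((partner-apart ∷ φ≢x ∷ []) ∷ (φ≢x ∷ []) ∷ [] ∷ []) h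
  shape-three (crossing c) = three (crossing-distinct (Crossing.pivot c)) (Crossing.members c)

  half-view : ∀ {i j C s} → Half i j C → s ∈ C → (∃ λ j′ → Half i j′ C × s ≡ φ i j′) ⊎ s ≡ (x i , side j)
  half-view {j = j} h s∈C with ∈-triple (≈C⇒⊆ h s∈C)
  ... | inj₁ e          = inj₁ (j , h , e)
  ... | inj₂ (inj₁ e)   = inj₁ (partner j , Half-partner j h , e)
  ... | inj₂ (inj₂ e)   = inj₂ e

  half-φ-remainder : ∀ {t i j C} → Half i j C → terminal (φ i j) ≡ t →
    Remainder t C (φ i (partner j)) (x i , side j)
  half-φ-remainder {i = i} {j} h refl =
    remainder (≈C⇒⊇ h (there (here refl))) (≈C⇒⊇ h (there (there (here refl)))) φ≢x
              (λ e → partner-≢ j (φ-distinct i _ _ e)) (x-fresh i i j)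

  half-x-remainder : ∀ {i j C} → Half i j C → Remainder (x i) C (φ i j) (φ i (partner j))
  half-x-remainder {i} {j} h =
    remainder (≈C⇒⊇ h (here refl)) (≈C⇒⊇ h (there (here refl))) partner-apart
              (λ e → x-fresh i i j (sym e)) (λ e → x-fresh i i (partner j) (sym e))

  crossing-ℓ-remainder : ∀ {t i j k l C} → Crossing i j k l C → terminal (φ i (partner j)) ≡ t →
    Remainder t C (x i , side j) (x k , side l)
  crossing-ℓ-remainder {i = i} {j} {k} c refl =
    remainder (≈C⇒⊇ members (there (here refl))) (≈C⇒⊇ members (there (there (here refl))))
              (complementary-x-apart refl pivot) (x-fresh i i (partner j)) (x-fresh k i (partner j))
    where open Crossing c

  crossing-x-remainder : ∀ {i j k l C} → Crossing i j k l C → Remainder (x i) C (φ i (partner j)) (x k , side l)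
  crossing-x-remainder {i} {j} c =
    remainder (≈C⇒⊇ members (here refl)) (≈C⇒⊇ members (there (there (here refl)))) φ≢x
              (λ e → x-fresh i i (partner j) (sym e)) (λ e → Crossing-rows-apart c (sym (x-injective _ _ e)))
    where open Crossing c

  halves-x-short : ∀ {i j k l C D R} → Half i j C → Half k l D → (x i , not (side j)) ∈ D →
    ResolventOn (x i) C D R → length R ≤ 3 → ⊥
  halves-x-short {i} {j} {k} {l} h h′ x̄∈D res len with half-view h′ x̄∈D
  ... | inj₁ (_ , _ , e) = x≢φ e
  ... | inj₂ e with x-injective _ _ (cong terminal e)
  ...   | refl =
    resolvent-too-long res (half-x-remainder h) (half-x-remainder h′)
      (apart refl refl) (apart refl (side-partner l)) (apart (side-partner j) refl)
      (apart (side-partner j) (side-partner l)) len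
    where
    apart : ∀ {a b} → side a ≡ side j → side b ≡ side l → φ i a ≢ φ i b
    apart = opposite-sides-apart (sym (cong proj₂ e))

  halves-φ-resolvent : ∀ {i j k l C D R} → Half i j C → Half k l D → negate (φ i j) ∈ D →
    ResolventOn (terminal (φ i j)) C D R → length R ≤ 3 → Crossed R
  halves-φ-resolvent {i} {j} {k} h h′ φ̄∈D res len with half-view h′ φ̄∈D
  ... | inj₂ e = ⊥-elim (x-fresh k i j (sym (cong terminal e)))
  ... | inj₁ (l , h″ , e) with φ i (partner j) ≟ₜ φ k (partner l)
  ...   | no differ =
    ⊥-elim (resolvent-too-long res rC rD differ φ≢x x≢φ (complementary-x-apart refl (sym e)) len)
    where
    rC = half-φ-remainder h refl
    rD = half-φ-remainder h″ (sym (cong terminal e))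
  ...   | yes shared = i , j , k , l , record
    { shared  = shared
    ; pivot   = sym e
    ; members = short-superset-≈ (crossing-distinct (sym e)) (All.lookup (ℓ∈R ∷ xi∈R ∷ xk∈R ∷ [])) len
    }
    where
    ℓ∈R  = proj₁ (remainder-⊆ res (half-φ-remainder h refl))
    xi∈R = proj₂ (remainder-⊆ res (half-φ-remainder h refl))
    xk∈R = proj₂ (remainder-⊆ (ResolventOn-sym res) (half-φ-remainder h″ (sym (cong terminal e))))

  halves-resolvent : ∀ {t i j k l C D R} → Half i j C → Half k l D → ResolventOn t C D R → length R ≤ 3 →
    Crossed R
  halves-resolvent h h′ res len with resolvent-pivot res
  ... | s , refl , s∈C , s̄∈D with half-view h s∈C
  ...   | inj₁ (_ , h″ , refl) = halves-φ-resolvent h″ h′ s̄∈D res len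
  ...   | inj₂ refl            = ⊥-elim (halves-x-short h h′ s̄∈D res len)

  crossing-ℓ-short : ∀ {i j k l C D R} → Crossing i j k l C → Shape D → negate (φ i (partner j)) ∈ D →
    ResolventOn (terminal (φ i (partner j))) C D R → length R ≤ 3 → ⊥
  crossing-ℓ-short {i} {j} c (half h) ℓ̄∈D res len with half-view h ℓ̄∈D
  ... | inj₂ e = x-fresh _ i (partner j) (sym (cong terminal e))
  ... | inj₁ (_ , h′ , e) =
    resolvent-too-long res (crossing-ℓ-remainder c refl) (half-φ-remainder h′ (sym (cong terminal e)))
      x≢φ (complementary-x-apart refl (sym e)) x≢φ (complementary-x-apart (sym (Crossing.shared c)) (sym e)) len
  crossing-ℓ-short {i} {j} c (crossing d) ℓ̄∈D res len with ∈-triple (≈C⇒⊆ (Crossing.members d) ℓ̄∈D)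
  ... | inj₂ (inj₁ e) = x-fresh _ i (partner j) (sym (cong terminal e))
  ... | inj₂ (inj₂ e) = x-fresh _ i (partner j) (sym (cong terminal e))
  ... | inj₁ e =
    resolvent-too-long res (crossing-ℓ-remainder c refl) (crossing-ℓ-remainder d (sym (cong terminal e)))
      (complementary-x-apart refl ℓ̄-row-m) (complementary-x-apart refl ℓ̄-row-q)
      (complementary-x-apart ℓ-row-k ℓ̄-row-m) (complementary-x-apart ℓ-row-k ℓ̄-row-q) len
    where
    ℓ-row-k  = sym (Crossing.shared c)
    ℓ̄-row-m = sym e
    ℓ̄-row-q = trans (sym (Crossing.shared d)) (sym e)

  crossings-x-short : ∀ {i j k l m p q r C D R} → Crossing i j k l C → Crossing m p q r D →
    (x i , not (side j)) ≡ (x m , side p) → ResolventOn (x i) C D R → length R ≤ 3 → ⊥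
  crossings-x-short {i} {j} {k} {l} {m} {p} {q} {r} c d e res len with x-injective _ _ (cong terminal e)
  ... | refl =
    resolvent-too-long res (crossing-x-remainder c) (crossing-x-remainder d)
      (opposite-sides-apart sp (side-partner j) (side-partner p)) φ≢x x≢φ xk≢xq len
    where
    sp : side p ≡ not (side j)
    sp = sym (cong proj₂ e)
    -- With k = q, the shared terms of C and D sit on one side of row k: either at the same
    -- position, or D's at C's pivot position l, whose term is ¬φ i j.
    xk≢xq : (x k , side l) ≢ (x q , side r)
    xk≢xq eq with x-injective _ _ (cong terminal eq)
    ... | refl with same-side (partner r) (partner l)
                      (trans (side-partner r) (trans (sym (cong proj₂ eq)) (sym (side-partner l))))
    ...   | inj₁ pr≡pl =
      opposite-sides-apart sp (side-partner j) (side-partner p)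
        (trans (Crossing.shared c) (trans (cong (φ k) (sym pr≡pl)) (sym (Crossing.shared d))))
    ...   | inj₂ pr≡ppl =
      complementary-rows-apart refl
        (trans (Crossing.shared d) (trans (cong (φ k) (trans pr≡ppl (partner-involutive l))) (Crossing.pivot c)))
        refl

  crossing-x-short : ∀ {i j k l C D R} → Crossing i j k l C → Shape D → (x i , not (side j)) ∈ D →
    ResolventOn (x i) C D R → length R ≤ 3 → ⊥
  crossing-x-short {i} {j} c (half h) x̄∈D res len with half-view h x̄∈D
  ... | inj₁ (_ , _ , e) = x≢φ e
  ... | inj₂ e with x-injective _ _ (cong terminal e)
  ...   | refl =
    resolvent-too-long res (crossing-x-remainder c) (half-x-remainder h)
      (opposite-sides-apart sp (side-partner j) refl) (opposite-sides-apart sp (side-partner j) (side-partner _))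
      x≢φ x≢φ len
    where
    sp = sym (cong proj₂ e)
  crossing-x-short c (crossing d) x̄∈D res len with ∈-triple (≈C⇒⊆ (Crossing.members d) x̄∈D)
  ... | inj₁ e        = x≢φ e
  ... | inj₂ (inj₁ e) = crossings-x-short c d e res len
  ... | inj₂ (inj₂ e) = crossings-x-short c (Crossing-swap d) e res len

  crossing-short : ∀ {t i j k l C D R} → Crossing i j k l C → Shape D → ResolventOn t C D R → length R ≤ 3 → ⊥
  crossing-short c sD res len with resolvent-pivot res
  ... | s , refl , s∈C , s̄∈D with ∈-triple (≈C⇒⊆ (Crossing.members c) s∈C)
  ...   | inj₁ refl          = crossing-ℓ-short c sD s̄∈D res len
  ...   | inj₂ (inj₁ refl)   = crossing-x-short c sD s̄∈D res len
  ...   | inj₂ (inj₂ refl)   = crossing-x-short (Crossing-swap c) sD s̄∈D res len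

  input-half : ∀ {C} → InRound φ′ 0 C → ∃₂ λ i j → Half i j C
  input-half (input D∈φ′ _ C≈D) with satisfied (∈-concatMap⁻ (λ i → halfClause i 0F ∷ halfClause i 2F ∷ []) {allFin n} D∈φ′)
  ... | i , here refl         = i , 0F , C≈D
  ... | i , there (here refl) = i , 2F , C≈D

  input-length : ∀ {C} → InRound φ′ 0 C → length C ≤ 3
  input-length r@(input _ uniqueC _) = Unique-⊆⇒length≤ uniqueC (≈C⇒⊆ (proj₂ (proj₂ (input-half r))))

  record InputResolvent (R : Clause) : Set where
    constructor input-resolvent
    field
      {t}        : Terminal
      {C D}      : Clause
      C-input    : InRound φ′ 0 C
      D-input    : InRound φ′ 0 D
      resolves   : ResolventOn t C D R
      consistent : NoComplementary R
      short      : length R ≤ 3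

  InputResolvent-crossed : ∀ {R} → InputResolvent R → Crossed R
  InputResolvent-crossed (input-resolvent rC rD res _ len) with input-half rC | input-half rD
  ... | _ , _ , h | _ , _ , h′ = halves-resolvent h h′ res len

  Round1 : Clause → Set
  Round1 C = InRound φ′ 0 C ⊎ InputResolvent C

  Round1-shape : ∀ {C} → Round1 C → Shape C
  Round1-shape (inj₁ r)  = half (proj₂ (proj₂ (input-half r)))
  Round1-shape (inj₂ ir) = crossing (proj₂ (proj₂ (proj₂ (proj₂ (InputResolvent-crossed ir)))))

  Round1-sound : ∀ {C} → Round1 C → InRound φ′ 1 C
  Round1-sound (inj₁ r) = keep r
  Round1-sound (inj₂ (input-resolvent rC rD res consistent len)) =
    resolve _ rC (input-length rC) rD (input-length rD) res consistent len

  Round1-resp-≈ : ∀ {C E} → Round1 C → Unique E → E ≈C C → length E ≤ 3 → Round1 E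
  Round1-resp-≈ (inj₁ (input D∈φ′ _ C≈D)) uniqueE E≈C _ = inj₁ (input D∈φ′ uniqueE (≈C-trans E≈C C≈D))
  Round1-resp-≈ (inj₂ (input-resolvent rC rD res consistent _)) uniqueE E≈C len =
    inj₂ (input-resolvent rC rD (ResolventOn-resp-≈ uniqueE E≈C res)
                          (λ t p q → consistent t (≈C⇒⊆ E≈C p) (≈C⇒⊆ E≈C q)) len)

  Round1-expand : ∀ {C E} → Round1 C → Unique E → (∀ s → s ∈ C → s ∈ E) → length E ≤ 3 → Round1 E
  Round1-expand rC uniqueE C⊆E len =
    Round1-resp-≈ rC uniqueE (ThreeTerms-⊆-short (shape-three (Round1-shape rC)) (C⊆E _) len) len

  Round1-resolve : ∀ {t C D R} → Round1 C → Round1 D → ResolventOn t C D R → NoComplementary R → length R ≤ 3 →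
    Round1 R
  Round1-resolve (inj₁ rC) (inj₁ rD) res consistent len = inj₂ (input-resolvent rC rD res consistent len)
  Round1-resolve (inj₂ ir) rD res _ len with InputResolvent-crossed ir
  ... | _ , _ , _ , _ , c = ⊥-elim (crossing-short c (Round1-shape rD) res len)
  Round1-resolve (inj₁ rC) (inj₂ ir) res _ len with InputResolvent-crossed ir
  ... | _ , _ , _ , _ , c = ⊥-elim (crossing-short c (Round1-shape (inj₁ rC)) (ResolventOn-sym res) len)

  round1⇒Round1 : ∀ {C} → InRound φ′ 1 C → Round1 C
  round1⇒Round1 (keep r) = inj₁ r
  round1⇒Round1 (resolve _ rC _ rD _ res consistent len) = inj₂ (input-resolvent rC rD res consistent len)
  round1⇒Round1 (expand r _ (uniqueE , _) C⊆E _ len) = Round1-expand (inj₁ r) uniqueE C⊆E len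

  round2⇒Round1 : ∀ {C} → InRound φ′ 2 C → Round1 C
  round2⇒Round1 (keep r) = round1⇒Round1 r
  round2⇒Round1 (resolve _ rC _ rD _ res consistent len) =
    Round1-resolve (round1⇒Round1 rC) (round1⇒Round1 rD) res consistent len
  round2⇒Round1 (expand r _ (uniqueE , _) C⊆E _ len) = Round1-expand (round1⇒Round1 r) uniqueE C⊆E len

  Round1-no-unit : ∀ {s} → ¬ Round1 (s ∷ [])
  Round1-no-unit r with ThreeTerms⇒3≤length (shape-three (Round1-shape r))
  ... | s≤s ()

  quigley-satisfiable : QuigleyOutputsSatisfiable φ′
  quigley-satisfiable = 1 , (λ _ r → Round1-sound (round2⇒Round1 r)) , no-contradiction
    where
    no-contradiction : ∀ j → 1 ≤ j → j ≤ 2 → ¬ Contradiction φ′ j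
    no-contradiction 1 _ _ (_ , unit , _) = Round1-no-unit (round1⇒Round1 unit)
    no-contradiction 2 _ _ (_ , unit , _) = Round1-no-unit (round2⇒Round1 unit)
    no-contradiction (suc (suc (suc _))) _ (s≤s (s≤s ()))

mainTheorem2 :
    (n : ℕ) (φ : Fin n → Fin 4 → Term) →
    (∀ i j k → terminal (φ i j) ≡ terminal (φ i k) → j ≡ k) →
    ¬ Satisfiable (fourCNF n φ) →
    (x : Fin n → Terminal) →
    (∀ i j → x i ≡ x j → i ≡ j) →
    (∀ i j k → x i ≢ terminal (φ j k)) →
    QuigleyOutputsSatisfiable (phi′ n φ x) × ¬ Satisfiable (phi′ n φ x)
mainTheorem2 n φ φ-distinct φ-unsatisfiable x x-injective x-fresh =
  quigley-satisfiable n φ φ-distinct x x-injective x-fresh ,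
  λ sat → φ-unsatisfiable (phi′-satisfiable⇒fourCNF-satisfiable n φ x sat)
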